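{- Let $k \geq 1$ be an integer, and let $T_k$ be a tournament with $\vec{\omega}(T_k) = k$ for which there is a tournament $T$ with $\vec{\omega}(T) = k$ such that for every $X \subseteq V(T_k)$, $T_k[X]$ or $T_k[V(T_k)\setminus X]$ contains a copy of $T$. If $D$ is a digraph with $\vec{\omega}(D) = k-1$, then $\vec{\omega}(\Delta(1, D, T_k)) = k$ and $$\{\prec \;:\; \prec \text{ a total order of } V(D),\ \omega(D^{\prec}) = k-1\} = \{\prec|_{V(D)} \;:\; \prec \text{ a total order of } V(\Delta(1,D,T_k)),\ \omega(\Delta(1, D, T_k)^{\prec}) = k\}.$$
   Context: A tournament is an orientation of a complete graph. For a digraph $D$ and a total order $\prec$ on $V(D)$, the backedge graph $D^{\prec}$ is the undirected graph on $V(D)$ in which $x,y$ with $x \prec y$ are adjacent if and only if $yx \in A(D)$; and $\vec{\omega}(D) = \min_{\prec} \omega(D^{\prec})$ over all total orders of $V(D)$. For digraphs $D_1, D_2, D_3$, $\Delta(D_1,D_2,D_3)$ is obtained from disjoint copies of $D_1,D_2,D_3$ by adding all arcs from $V(D_1)$ to $V(D_2)$, from $V(D_2)$ to $V(D_3)$ and from $V(D_3)$ to $V(D_1)$; the argument $1$ stands for the one-vertex tournament. $\prec|_Y$ denotes the restriction of $\prec$ to $Y$. A copy of $T$ is a subtournament isomorphic to $T$. -}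

module Defs where

open import Data.Nat using (ℕ; _≤_)
open import Data.Bool using (Bool; true; false)
open import Data.Fin using (Fin; zero; splitAt; _↑ˡ_; _↑ʳ_)
open import Data.Fin.Subset using (Subset; _∈_; ∣_∣; ∁)
open import Data.Sum using (_⊎_; inj₁; inj₂)
open import Data.Product using (Σ; _×_; ∃)
open import Relation.Binary.PropositionalEquality using (_≡_; _≢_)
open import Relation.Binary.Definitions using (Trichotomous)
open import Relation.Binary.Structures using (IsStrictTotalOrder)
open import Function.Definitions using (Injective)

-- A digraph on vertex set Fin n: arc x y = true iff xy is an arc.
Digraph : ℕ → Set
Digraph n = Fin n → Fin n → Bool

Loopless : ∀ {n} → Digraph n → Set
Loopless {n} D = (x : Fin n) → D x x ≡ false

IsTournament : ∀ {n} → Digraph n → Set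
IsTournament {n} D = Loopless D × ((x y : Fin n) → x ≢ y → D x y ≢ D y x)

IsTotalOrder : ∀ {n} → (Fin n → Fin n → Set) → Set
IsTotalOrder R = IsStrictTotalOrder _≡_ R

-- Backedge graph D^≺ (an undirected graph, as a symmetric relation):
-- x, y adjacent iff (x ≺ y and yx is an arc) or (y ≺ x and xy is an arc).
Backedge : ∀ {n} → Digraph n → (Fin n → Fin n → Set) → Fin n → Fin n → Set
Backedge D R x y = (R x y × D y x ≡ true) ⊎ (R y x × D x y ≡ true)

IsClique : ∀ {n} → (Fin n → Fin n → Set) → Subset n → Set
IsClique {n} G S = (x y : Fin n) → x ∈ S → y ∈ S → x ≢ y → G x y

CliqueNumber : ∀ {n} → (Fin n → Fin n → Set) → ℕ → Set
CliqueNumber {n} G m =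
  (Σ (Subset n) λ S → IsClique G S × ∣ S ∣ ≡ m)
  × ((S : Subset n) → IsClique G S → ∣ S ∣ ≤ m)

DiCliqueNumber : ∀ {n} → Digraph n → ℕ → Set₁
DiCliqueNumber {n} D k =
  (Σ (Fin n → Fin n → Set) λ R → IsTotalOrder R × CliqueNumber (Backedge D R) k)
  × ((R : Fin n → Fin n → Set) → IsTotalOrder R → (m : ℕ) →
       CliqueNumber (Backedge D R) m → k ≤ m)

-- T₁[X] contains a copy of T (T on Fin m, T₁ on Fin p): an injective map
-- into X which is an isomorphism onto the induced subdigraph.
ContainsCopy : ∀ {p m} → Digraph p → Subset p → Digraph m → Set
ContainsCopy {p} {m} T₁ X T =
  Σ (Fin m → Fin p) λ f → Injective _≡_ _≡_ f × ((a : Fin m) → f a ∈ X)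
    × ((a b : Fin m) → T₁ (f a) (f b) ≡ T a b)

One : Digraph 1
One _ _ = false

-- Vertex set of Δ(D₁,D₂,D₃) is Fin (a + (b + c)); split into the three parts.
part : ∀ {a b c} → Fin (a Data.Nat.+ (b Data.Nat.+ c)) → Fin a ⊎ (Fin b ⊎ Fin c)
part {a} {b} {c} u with splitAt a u
... | inj₁ x = inj₁ x
... | inj₂ v = inj₂ (splitAt b v)

ΔArc : ∀ {a b c} → Fin a ⊎ (Fin b ⊎ Fin c) → Fin a ⊎ (Fin b ⊎ Fin c) →
       Digraph a → Digraph b → Digraph c → Bool
ΔArc (inj₁ x) (inj₁ y) D₁ D₂ D₃ = D₁ x y
ΔArc (inj₁ x) (inj₂ (inj₁ y)) D₁ D₂ D₃ = true
ΔArc (inj₁ x) (inj₂ (inj₂ y)) D₁ D₂ D₃ = false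
ΔArc (inj₂ (inj₁ x)) (inj₁ y) D₁ D₂ D₃ = false
ΔArc (inj₂ (inj₁ x)) (inj₂ (inj₁ y)) D₁ D₂ D₃ = D₂ x y
ΔArc (inj₂ (inj₁ x)) (inj₂ (inj₂ y)) D₁ D₂ D₃ = true
ΔArc (inj₂ (inj₂ x)) (inj₁ y) D₁ D₂ D₃ = true
ΔArc (inj₂ (inj₂ x)) (inj₂ (inj₁ y)) D₁ D₂ D₃ = false
ΔArc (inj₂ (inj₂ x)) (inj₂ (inj₂ y)) D₁ D₂ D₃ = D₃ x y

-- Δ(D₁, D₂, D₃): all arcs D₁ → D₂, D₂ → D₃, D₃ → D₁.
Δ : ∀ {a b c} → Digraph a → Digraph b → Digraph c → Digraph (a Data.Nat.+ (b Data.Nat.+ c))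
Δ {a} {b} {c} D₁ D₂ D₃ u v = ΔArc {a} {b} {c} (part u) (part v) D₁ D₂ D₃

ιD : ∀ {n p} → Fin n → Fin (1 Data.Nat.+ (n Data.Nat.+ p))
ιD {n} {p} x = 1 ↑ʳ (x ↑ˡ p)

restrictD : ∀ {n p} → (Fin (1 Data.Nat.+ (n Data.Nat.+ p)) → Fin (1 Data.Nat.+ (n Data.Nat.+ p)) → Set) →
            Fin n → Fin n → Set
restrictD {n} {p} R x y = R (ιD {n} {p} x) (ιD {n} {p} y)

module Submission where

-- Write G = Δ(1, D, Tₖ) with apex v. Every order of G restricts to an order of Tₖ, so its backedge
-- graph has a clique of size k. Ordering V(D) optimally, then V(Tₖ) optimally, then v, the only
-- backedges leaving D or Tₖ join v to V(D), and no vertex of Tₖ is adjacent to v or to V(D); hence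
-- every clique lies in Tₖ or in {v} ∪ V(D) and has at most max(k, (k - 1) + 1) = k vertices.
-- Conversely, let ≺ be an order of G whose backedge graph has clique number k. If some x ∈ V(D)
-- came after v, split V(Tₖ) into the vertices before and after v: one side contains a copy of T,
-- whose backedge graph has a clique of size k, and this clique together with x (if the copy lies
-- before v) or with v (if it lies after v) would have k + 1 vertices. So V(D) precedes v, v is
-- adjacent to all of V(D), and cliques of D under ≺ have at most k - 1 vertices, while ω⃗(D) = k - 1
-- gives one of size k - 1.

open import Defs
open import Data.Bool using (true; false)
open import Data.Bool.Properties using () renaming (_≟_ to _≟ᵇ_)
open import Data.Empty using (⊥-elim)
open import Data.Fin using (Fin; zero; suc; _↑ʳ_; splitAt; join; punchIn; inject≤; _<_)
open import Data.Fin.Properties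
  using (any?; all?; injective⇒≤; suc-injective; punchIn-injective; punchInᵢ≢i; inject≤-injective;
         splitAt-↑ˡ; splitAt-↑ʳ; splitAt⁻¹-↑ˡ; splitAt⁻¹-↑ʳ; join-splitAt; ↑ˡ-injective; ↑ʳ-injective;
         <-isStrictTotalOrder)
  renaming (_≟_ to _≟ᶠ_)
open import Data.Fin.Subset using (Subset; _∈_; ∣_∣; ∁; inside; outside) renaming (⊥ to ∅)
open import Data.Fin.Subset.Properties using (anySubset?; ∣p∣≤n; ∉⊥; x∈∁p⇒x∉p; _∈?_)
open import Data.Nat using (ℕ; zero; suc; _≤_; _∸_; _+_; z≤n; s≤s; s≤s⁻¹)
open import Data.Nat.Properties using (≤∧≢⇒<; ≤-antisym; ≤-refl; ≤-trans; m≤n⇒m≤1+n; 1+n≰n)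
  renaming (_≤?_ to _≤ℕ?_)
open import Data.Product using (Σ; _×_; _,_; proj₁; proj₂; ∃)
open import Data.Sum using (_⊎_; inj₁; inj₂; swap)
open import Data.Sum.Properties using (inj₂-injective; swap-involutive)
open import Data.Sum.Relation.Binary.LeftOrder
  using (_⊎-<_; ₁∼₁; ₂∼₂; drop-inj₁; drop-inj₂; ⊎-<-isStrictTotalOrder)
open import Data.Sum.Relation.Binary.Pointwise as PW using (Pointwise; Pointwise-≡⇒≡)
open import Data.Vec using (_∷_; []; tabulate; here; there)
open import Data.Vec.Properties using (lookup∘tabulate; []=⇒lookup; lookup⇒[]=)
open import Function.Base using (_∘_; _on_; id)
open import Function.Bundles using (_⇔_; mk⇔; Equivalence)
open import Function.Definitions using (Injective)
open import Relation.Binary.Core using (Rel)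
open import Relation.Binary.Definitions using (Decidable; Trichotomous; tri<; tri≈; tri>)
open import Relation.Binary.Structures using (IsStrictTotalOrder)
open import Relation.Binary.PropositionalEquality
  using (_≡_; _≢_; refl; sym; trans; cong; subst; subst₂; isEquivalence; module ≡-Reasoning)
open import Relation.Nullary using (¬_; yes; no; does)
open import Relation.Nullary.Decidable using (_×-dec_; _⊎-dec_; _→-dec_; ¬?)
open import Relation.Unary using (Pred) renaming (Decidable to Decidable₁)
open import Level using (0ℓ)

private
  variable
    m n N k : ℕ

subsetOf : {P : Pred (Fin n) 0ℓ} → Decidable₁ P → Subset n
subsetOf P? = tabulate (does ∘ P?)

∈-subsetOf : {P : Pred (Fin n) 0ℓ} (P? : Decidable₁ P) {x : Fin n} → x ∈ subsetOf P? ⇔ P x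
∈-subsetOf {P = P} P? {x} = mk⇔ to from
  where
  to : x ∈ subsetOf P? → P x
  to x∈ with P? x | trans (sym (lookup∘tabulate (does ∘ P?) x)) ([]=⇒lookup x∈)
  ... | yes Px | _  = Px
  ... | no _   | ()
  from : P x → x ∈ subsetOf P?
  from Px with P? x in eq
  ... | yes _  = lookup⇒[]= x _ (trans (lookup∘tabulate (does ∘ P?) x) (cong does eq))
  ... | no ¬Px = ⊥-elim (¬Px Px)

bounded-maximum : {P : Pred ℕ 0ℓ} → Decidable₁ P → P 0 → ∀ b → (∀ {m} → P m → m ≤ b) →
                  ∃ λ m → P m × (∀ {m′} → P m′ → m′ ≤ m)
bounded-maximum P? P0 zero    bound = 0 , P0 , bound
bounded-maximum P? P0 (suc b) bound with P? (suc b)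
... | yes P[1+b] = suc b , P[1+b] , bound
... | no ¬P[1+b] = bounded-maximum P? P0 b λ Pm →
  s≤s⁻¹ (≤∧≢⇒< (bound Pm) λ { refl → ¬P[1+b] Pm })

record Enumeration (S : Subset n) : Set where
  field
    element   : Fin ∣ S ∣ → Fin n
    injective : Injective _≡_ _≡_ element
    element∈  : ∀ i → element i ∈ S
    index     : ∀ {x} → x ∈ S → ∃ λ i → element i ≡ x

enumerate : (S : Subset n) → Enumeration S
enumerate [] = record { element = λ () ; injective = λ { {()} } ; element∈ = λ () ; index = λ () }
enumerate (outside ∷ S) = record
  { element   = suc ∘ element
  ; injective = injective ∘ suc-injective
  ; element∈  = there ∘ element∈
  ; index     = λ { (there x∈S) → let i , eᵢ = index x∈S in i , cong suc eᵢ }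
  }
  where open Enumeration (enumerate S)
enumerate {suc n} (inside ∷ S) = record
  { element   = element′
  ; injective = injective′
  ; element∈  = λ { zero → here ; (suc i) → there (element∈ i) }
  ; index     = λ { here → zero , refl ; (there x∈S) → let i , eᵢ = index x∈S in suc i , cong suc eᵢ }
  }
  where
  open Enumeration (enumerate S)
  element′ : Fin (suc ∣ S ∣) → Fin (suc n)
  element′ zero    = zero
  element′ (suc i) = suc (element i)
  injective′ : Injective _≡_ _≡_ element′
  injective′ {zero}  {zero}  _ = refl
  injective′ {suc i} {suc j} e = cong suc (injective (suc-injective e))

inImage? : (f : Fin m → Fin N) → Decidable₁ λ x → ∃ λ i → f i ≡ x
inImage? f x = any? λ i → f i ≟ᶠ x

image : (Fin m → Fin N) → Subset N
image f = subsetOf (inImage? f)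

injective⇒≤∣image∣ : {f : Fin m → Fin N} → Injective _≡_ _≡_ f → m ≤ ∣ image f ∣
injective⇒≤∣image∣ {m = m} {f = f} f-inj = injective⇒≤ {f = position} λ {i} {j} e →
  f-inj (trans (sym (proj₂ (located i))) (trans (cong element e) (proj₂ (located j))))
  where
  open Enumeration (enumerate (image f))
  located : ∀ i → ∃ λ p → element p ≡ f i
  located i = index (Equivalence.from (∈-subsetOf (inImage? f)) (i , refl))
  position : Fin m → Fin ∣ image f ∣
  position = proj₁ ∘ located

record Clique (G : Rel (Fin N) 0ℓ) (m : ℕ) : Set where
  field
    member    : Fin m → Fin N
    injective : Injective _≡_ _≡_ member
    adjacent  : ∀ {i j} → i ≢ j → G (member i) (member j)
open Clique using (member; adjacent)

module _ {G : Rel (Fin N) 0ℓ} where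

  subset⇒clique : {S : Subset N} → IsClique G S → Clique G ∣ S ∣
  subset⇒clique {S} S-clique = record
    { member    = element
    ; injective = injective
    ; adjacent  = λ i≢j → S-clique _ _ (element∈ _) (element∈ _) (i≢j ∘ injective)
    }
    where open Enumeration (enumerate S)

  clique⇒subset : Clique G m → ∃ λ S → IsClique G S × m ≤ ∣ S ∣
  clique⇒subset c = image (member c) , image-clique , injective⇒≤∣image∣ (Clique.injective c)
    where
    image-clique : IsClique G (image (member c))
    image-clique x y x∈ y∈ x≢y
      with Equivalence.to (∈-subsetOf (inImage? (member c))) x∈
         | Equivalence.to (∈-subsetOf (inImage? (member c))) y∈
    ... | i , refl | j , refl = adjacent c λ { refl → x≢y refl }

  clique≤cliqueNumber : CliqueNumber G k → Clique G m → m ≤ k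
  clique≤cliqueNumber (_ , maximal) c =
    let S , S-clique , m≤∣S∣ = clique⇒subset c in ≤-trans m≤∣S∣ (maximal S S-clique)

  cliqueNumber⇒clique : CliqueNumber G k → Clique G k
  cliqueNumber⇒clique ((S , S-clique , refl) , _) = subset⇒clique S-clique

  isClique? : Decidable G → Decidable₁ (IsClique G)
  isClique? G? S = all? λ x → all? λ y →
    x ∈? S →-dec y ∈? S →-dec ¬? (x ≟ᶠ y) →-dec G? x y

  cliqueNumber-exists : Decidable G → ∃ (CliqueNumber G)
  cliqueNumber-exists G? =
    let k , (S , S-clique , k≤∣S∣) , maximal =
          bounded-maximum large? (∅ , (λ _ _ x∈∅ → ⊥-elim (∉⊥ x∈∅)) , z≤n) N
            λ (S , _ , m≤∣S∣) → ≤-trans m≤∣S∣ (∣p∣≤n S)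
    in k , (S , S-clique , ≤-antisym (maximal (S , S-clique , ≤-refl)) k≤∣S∣) ,
           λ T T-clique → maximal (T , T-clique , ≤-refl)
    where
    large? : Decidable₁ λ m → ∃ λ S → IsClique G S × m ≤ ∣ S ∣
    large? m = anySubset? λ S → isClique? G? S ×-dec m ≤ℕ? ∣ S ∣

  cliqueNumber-intro : Decidable G → Clique G k → (∀ {m} → Clique G m → m ≤ k) → CliqueNumber G k
  cliqueNumber-intro G? c bound =
    let M , ω = cliqueNumber-exists G? in
    subst (CliqueNumber G) (≤-antisym (bound (cliqueNumber⇒clique ω)) (clique≤cliqueNumber ω c)) ω

module _ {G : Rel (Fin N) 0ℓ} where

  clique-shrink : m ≤ k → Clique G k → Clique G m
  clique-shrink m≤k c = record
    { member    = member c ∘ inject≤′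
    ; injective = inject≤-injective m≤k m≤k _ _ ∘ Clique.injective c
    ; adjacent  = λ i≢j → adjacent c (i≢j ∘ inject≤-injective m≤k m≤k _ _)
    }
    where inject≤′ = λ i → inject≤ i m≤k

  clique-delete : Clique G (suc m) → Fin (suc m) → Clique G m
  clique-delete c i = record
    { member    = member c ∘ punchIn i
    ; injective = punchIn-injective i _ _ ∘ Clique.injective c
    ; adjacent  = λ j≢l → adjacent c (j≢l ∘ punchIn-injective i _ _)
    }

  clique-extend : (∀ {x y} → G x y → G y x) → (∀ {x} → ¬ G x x) →
                  (c : Clique G m) (w : Fin N) → (∀ i → G w (member c i)) → Clique G (suc m)
  clique-extend {m = m} G-sym G-irrefl c w w-adjacent = record
    { member = member′ ; injective = injective′ ; adjacent = adjacent′ }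
    where
    member′ : Fin (suc m) → Fin N
    member′ zero    = w
    member′ (suc i) = member c i
    injective′ : Injective _≡_ _≡_ member′
    injective′ {zero}  {zero}  _ = refl
    injective′ {zero}  {suc j} e = ⊥-elim (G-irrefl (subst (G w) (sym e) (w-adjacent j)))
    injective′ {suc i} {zero}  e = ⊥-elim (G-irrefl (subst (G w) e (w-adjacent i)))
    injective′ {suc i} {suc j} e = cong suc (Clique.injective c e)
    adjacent′ : ∀ {i j} → i ≢ j → G (member′ i) (member′ j)
    adjacent′ {zero}  {zero}  i≢j = ⊥-elim (i≢j refl)
    adjacent′ {zero}  {suc j} _   = w-adjacent j
    adjacent′ {suc i} {zero}  _   = G-sym (w-adjacent i)
    adjacent′ {suc i} {suc j} i≢j = adjacent c (i≢j ∘ cong suc)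

  clique-closed : {P : Pred (Fin N) 0ℓ} (c : Clique G m) (i : Fin m) →
                  P (member c i) → (∀ u → G (member c i) u → P u) → ∀ j → P (member c j)
  clique-closed c i Pᵢ closed j with j ≟ᶠ i
  ... | yes refl = Pᵢ
  ... | no j≢i   = closed _ (adjacent c (j≢i ∘ sym))

module _ {G : Rel (Fin m) 0ℓ} {H : Rel (Fin N) 0ℓ} {g : Fin m → Fin N} where

  clique-map : Injective _≡_ _≡_ g → (∀ {x y} → G x y → H (g x) (g y)) → Clique G k → Clique H k
  clique-map g-inj G⇒H c = record
    { member    = g ∘ member c
    ; injective = Clique.injective c ∘ g-inj
    ; adjacent  = G⇒H ∘ adjacent c
    }

  clique-pull : (∀ {x y} → H (g x) (g y) → G x y) →
                (c : Clique H k) → (∀ i → ∃ λ x → g x ≡ member c i) → Clique G k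
  clique-pull H⇒G c preimage = record
    { member    = proj₁ ∘ preimage
    ; injective = λ {i} {j} e → Clique.injective c (trans (sym (proj₂ (preimage i)))
                                                  (trans (cong g e) (proj₂ (preimage j))))
    ; adjacent  = λ {i} {j} i≢j → H⇒G (subst₂ H (sym (proj₂ (preimage i))) (sym (proj₂ (preimage j)))
                                                (adjacent c i≢j))
    }

isStrictTotalOrder-on : {A B : Set} {_≈_ _<_ : Rel B 0ℓ} (f : A → B) → (∀ {x y} → f x ≈ f y → x ≡ y) →
                        IsStrictTotalOrder _≈_ _<_ → IsStrictTotalOrder _≡_ (_<_ on f)
isStrictTotalOrder-on {_<_ = _<_} f f-inj O = record
  { isStrictPartialOrder = record
    { isEquivalence = isEquivalence
    ; irrefl        = λ { refl → O.irrefl O.Eq.refl }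
    ; trans         = O.trans
    ; <-resp-≈      = (λ { refl r → r }) , (λ { refl r → r })
    }
  ; compare = compare
  }
  where
  module O = IsStrictTotalOrder O
  compare : Trichotomous _≡_ (_<_ on f)
  compare x y with O.compare (f x) (f y)
  ... | tri< a ¬b ¬c = tri< a (λ { refl → ¬b O.Eq.refl }) ¬c
  ... | tri≈ ¬a b ¬c = tri≈ ¬a (f-inj b) ¬c
  ... | tri> ¬a ¬b c = tri> ¬a (λ { refl → ¬b O.Eq.refl }) c

module _ {D : Digraph n} {R : Rel (Fin n) 0ℓ} where

  backedge-sym : ∀ {x y} → Backedge D R x y → Backedge D R y x
  backedge-sym (inj₁ b) = inj₂ b
  backedge-sym (inj₂ b) = inj₁ b

  backedge-irrefl : IsTotalOrder R → ∀ {x} → ¬ Backedge D R x x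
  backedge-irrefl O (inj₁ (r , _)) = IsStrictTotalOrder.irrefl O refl r
  backedge-irrefl O (inj₂ (r , _)) = IsStrictTotalOrder.irrefl O refl r

  backedge? : IsTotalOrder R → Decidable (Backedge D R)
  backedge? O x y = (x <? y ×-dec D y x ≟ᵇ true) ⊎-dec (y <? x ×-dec D x y ≟ᵇ true)
    where open IsStrictTotalOrder O using (_<?_)

diCliqueNumber⇒clique : {D : Digraph n} {R : Rel (Fin n) 0ℓ} →
                        DiCliqueNumber D k → IsTotalOrder R → Clique (Backedge D R) k
diCliqueNumber⇒clique (_ , minimal) O =
  let M , ω = cliqueNumber-exists (backedge? O) in
  clique-shrink (minimal _ O M ω) (cliqueNumber⇒clique ω)

record Embedding (T : Digraph m) (E : Digraph N) : Set where
  field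
    vertex    : Fin m → Fin N
    injective : Injective _≡_ _≡_ vertex
    arc       : ∀ a b → E (vertex a) (vertex b) ≡ T a b

_∘ᴱ_ : {S : Digraph k} {T : Digraph m} {E : Digraph N} → Embedding T E → Embedding S T → Embedding S E
e ∘ᴱ e′ = record
  { vertex    = Embedding.vertex e ∘ Embedding.vertex e′
  ; injective = Embedding.injective e′ ∘ Embedding.injective e
  ; arc       = λ a b → trans (Embedding.arc e _ _) (Embedding.arc e′ a b)
  }

copy⇒embedding : {S : Digraph N} {X : Subset N} {T : Digraph m} → ContainsCopy S X T → Embedding T S
copy⇒embedding (f , f-inj , _ , f-arc) = record { vertex = f ; injective = f-inj ; arc = f-arc }

module _ {T : Digraph m} {E : Digraph N} (e : Embedding T E)
         {R₀ : Rel (Fin m) 0ℓ} {R : Rel (Fin N) 0ℓ} where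
  open Embedding e

  embedding-clique-map : (∀ {a b} → R₀ a b → R (vertex a) (vertex b)) →
                         Clique (Backedge T R₀) k → Clique (Backedge E R) k
  embedding-clique-map R₀⇒R = clique-map injective λ
    { (inj₁ (r , t)) → inj₁ (R₀⇒R r , trans (arc _ _) t)
    ; (inj₂ (r , t)) → inj₂ (R₀⇒R r , trans (arc _ _) t) }

  embedding-clique-pull : (∀ {a b} → R (vertex a) (vertex b) → R₀ a b) →
                          (c : Clique (Backedge E R) k) → (∀ i → ∃ λ a → vertex a ≡ member c i) →
                          Clique (Backedge T R₀) k
  embedding-clique-pull R⇒R₀ = clique-pull λ
    { (inj₁ (r , t)) → inj₁ (R⇒R₀ r , trans (sym (arc _ _)) t)
    ; (inj₂ (r , t)) → inj₂ (R⇒R₀ r , trans (sym (arc _ _)) t) }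

module _ {T : Digraph m} {E : Digraph N} {R : Rel (Fin N) 0ℓ} (O : IsTotalOrder R) where

  embedded-clique : Embedding T E → DiCliqueNumber T k → Clique (Backedge E R) k
  embedded-clique e ω⃗ = embedding-clique-map e id
    (diCliqueNumber⇒clique ω⃗ (isStrictTotalOrder-on (Embedding.vertex e) (Embedding.injective e) O))

  copy-not-dominated : CliqueNumber (Backedge E R) k → DiCliqueNumber T k → (e : Embedding T E) →
                       (w : Fin N) → ¬ (∀ a → Backedge E R w (Embedding.vertex e a))
  copy-not-dominated ω ω⃗ e w dominates = 1+n≰n (clique≤cliqueNumber ω
    (clique-extend (backedge-sym {D = E} {R = R}) (backedge-irrefl {D = E} O) (embedded-clique e ω⃗) w
                   (λ _ → dominates _)))

pointwise²⇒≡ : {A B C : Set} {x y : (A ⊎ B) ⊎ C} → Pointwise (Pointwise _≡_ _≡_) _≡_ x y → x ≡ y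
pointwise²⇒≡ (PW.inj₁ e) = cong inj₁ (Pointwise-≡⇒≡ e)
pointwise²⇒≡ (PW.inj₂ e) = cong inj₂ e

module Triangle {n p : ℕ} (D : Digraph n) (Tk : Digraph p) where

  V : Set
  V = Fin (1 + (n + p))

  G : Digraph (1 + (n + p))
  G = Δ One D Tk

  apex : V
  apex = zero

  ιᴰ : Fin n → V
  ιᴰ = ιD {n} {p}

  ιᵀ : Fin p → V
  ιᵀ t = 1 ↑ʳ (n ↑ʳ t)

  part-ιᴰ : ∀ x → part {1} {n} {p} (ιᴰ x) ≡ inj₂ (inj₁ x)
  part-ιᴰ x = cong inj₂ (splitAt-↑ˡ n x p)

  part-ιᵀ : ∀ t → part {1} {n} {p} (ιᵀ t) ≡ inj₂ (inj₂ t)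
  part-ιᵀ t = cong inj₂ (splitAt-↑ʳ n p t)

  part-injective : Injective _≡_ _≡_ (part {1} {n} {p})
  part-injective {zero}  {zero}  _ = refl
  part-injective {suc i} {suc j} e = cong suc (begin
    i                          ≡⟨ join-splitAt n p i ⟨
    join n p (splitAt n i)     ≡⟨ cong (join n p) (inj₂-injective e) ⟩
    join n p (splitAt n j)     ≡⟨ join-splitAt n p j ⟩
    j                          ∎)
    where open ≡-Reasoning

  ιᴰ≢ιᵀ : ∀ x t → ιᴰ x ≢ ιᵀ t
  ιᴰ≢ιᵀ x t e with () ← trans (sym (part-ιᴰ x)) (trans (cong part e) (part-ιᵀ t))

  arc : ∀ u w {a b} → part {1} {n} {p} u ≡ a → part {1} {n} {p} w ≡ b → G u w ≡ ΔArc a b One D Tk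
  arc _ _ refl refl = refl

  arc-apex-ιᴰ : ∀ x → G apex (ιᴰ x) ≡ true
  arc-apex-ιᴰ x = arc apex (ιᴰ x) refl (part-ιᴰ x)

  arc-ιᴰ-ιᵀ : ∀ x t → G (ιᴰ x) (ιᵀ t) ≡ true
  arc-ιᴰ-ιᵀ x t = arc (ιᴰ x) (ιᵀ t) (part-ιᴰ x) (part-ιᵀ t)

  arc-ιᵀ-apex : ∀ t → G (ιᵀ t) apex ≡ true
  arc-ιᵀ-apex t = arc (ιᵀ t) apex (part-ιᵀ t) refl

  no-arc-apex-ιᵀ : ∀ t → G apex (ιᵀ t) ≡ false
  no-arc-apex-ιᵀ t = arc apex (ιᵀ t) refl (part-ιᵀ t)

  no-arc-ιᵀ-ιᴰ : ∀ t x → G (ιᵀ t) (ιᴰ x) ≡ false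
  no-arc-ιᵀ-ιᴰ t x = arc (ιᵀ t) (ιᴰ x) (part-ιᵀ t) (part-ιᴰ x)

  D↪G : Embedding D G
  D↪G = record
    { vertex    = ιᴰ
    ; injective = ↑ˡ-injective p _ _ ∘ suc-injective
    ; arc       = λ x y → arc (ιᴰ x) (ιᴰ y) (part-ιᴰ x) (part-ιᴰ y)
    }

  T↪G : Embedding Tk G
  T↪G = record
    { vertex    = ιᵀ
    ; injective = ↑ʳ-injective n _ _ ∘ suc-injective
    ; arc       = λ s t → arc (ιᵀ s) (ιᵀ t) (part-ιᵀ s) (part-ιᵀ t)
    }

  data Vertex : V → Set where
    is-apex : Vertex apex
    is-D    : ∀ x → Vertex (ιᴰ x)
    is-T    : ∀ t → Vertex (ιᵀ t)

  classify : ∀ u → Vertex u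
  classify zero = is-apex
  classify (suc i) with splitAt n i in eq
  ... | inj₁ x = subst (Vertex ∘ suc) (splitAt⁻¹-↑ˡ eq) (is-D x)
  ... | inj₂ t = subst (Vertex ∘ suc) (splitAt⁻¹-↑ʳ eq) (is-T t)

  IsD IsT : V → Set
  IsD u = ∃ λ x → ιᴰ x ≡ u
  IsT u = ∃ λ t → ιᵀ t ≡ u

  isT? : Decidable₁ IsT
  isT? u with classify u
  ... | is-apex = no λ ()
  ... | is-D x  = no λ (t , e) → ιᴰ≢ιᵀ x t (sym e)
  ... | is-T t  = yes (t , refl)

  isD-if-not-apex-nor-T : ∀ {u} → u ≢ apex → ¬ IsT u → IsD u
  isD-if-not-apex-nor-T {u} u≢apex ¬T with classify u
  ... | is-apex = ⊥-elim (u≢apex refl)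
  ... | is-D x  = x , refl
  ... | is-T t  = ⊥-elim (¬T (t , refl))

  diCliqueNumber≤cliqueNumber : {R : Rel V 0ℓ} → DiCliqueNumber Tk k → IsTotalOrder R →
                                CliqueNumber (Backedge G R) m → k ≤ m
  diCliqueNumber≤cliqueNumber ω⃗ O ω = clique≤cliqueNumber ω (embedded-clique O T↪G ω⃗)

  module Glued {R : Rel (Fin n) 0ℓ} {Rᵀ : Rel (Fin p) 0ℓ} (O : IsTotalOrder R) (Oᵀ : IsTotalOrder Rᵀ) where

    key : V → (Fin n ⊎ Fin p) ⊎ Fin 1
    key = swap ∘ part {1} {n} {p}

    -- V(D) first, then V(Tₖ), then the apex.
    _⊏_ : Rel ((Fin n ⊎ Fin p) ⊎ Fin 1) 0ℓ
    _⊏_ = (R ⊎-< Rᵀ) ⊎-< _<_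

    _≺_ : Rel V 0ℓ
    _≺_ = _⊏_ on key

    key-injective : ∀ {u w} → key u ≡ key w → u ≡ w
    key-injective {u} {w} e = part-injective (begin
      part u               ≡⟨ swap-involutive (part u) ⟨
      swap (key u)         ≡⟨ cong swap e ⟩
      swap (key w)         ≡⟨ swap-involutive (part w) ⟩
      part w               ∎)
      where open ≡-Reasoning

    ≺-isTotalOrder : IsTotalOrder _≺_
    ≺-isTotalOrder = isStrictTotalOrder-on key (key-injective ∘ pointwise²⇒≡)
      (⊎-<-isStrictTotalOrder (⊎-<-isStrictTotalOrder O Oᵀ) <-isStrictTotalOrder)

    ≺⁺ : ∀ u w {a b} → key u ≡ a → key w ≡ b → a ⊏ b → u ≺ w
    ≺⁺ _ _ refl refl a⊏b = a⊏b

    ≺⁻ : ∀ u w {a b} → key u ≡ a → key w ≡ b → u ≺ w → a ⊏ b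
    ≺⁻ _ _ refl refl u≺w = u≺w

    key-ιᴰ : ∀ x → key (ιᴰ x) ≡ inj₁ (inj₁ x)
    key-ιᴰ x = cong swap (part-ιᴰ x)

    key-ιᵀ : ∀ t → key (ιᵀ t) ≡ inj₁ (inj₂ t)
    key-ιᵀ t = cong swap (part-ιᵀ t)

    ≺-ιᴰ : ∀ {x y} → R x y ⇔ ιᴰ x ≺ ιᴰ y
    ≺-ιᴰ {x} {y} = mk⇔ (≺⁺ (ιᴰ x) (ιᴰ y) (key-ιᴰ x) (key-ιᴰ y) ∘ ₁∼₁ ∘ ₁∼₁)
                       (drop-inj₁ ∘ drop-inj₁ ∘ ≺⁻ (ιᴰ x) (ιᴰ y) (key-ιᴰ x) (key-ιᴰ y))

    ≺-ιᵀ : ∀ {s t} → Rᵀ s t ⇔ ιᵀ s ≺ ιᵀ t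
    ≺-ιᵀ {s} {t} = mk⇔ (≺⁺ (ιᵀ s) (ιᵀ t) (key-ιᵀ s) (key-ιᵀ t) ∘ ₁∼₁ ∘ ₂∼₂)
                       (drop-inj₂ ∘ drop-inj₁ ∘ ≺⁻ (ιᵀ s) (ιᵀ t) (key-ιᵀ s) (key-ιᵀ t))

    ιᵀ≁apex : ∀ {t} → ¬ Backedge G _≺_ (ιᵀ t) apex
    ιᵀ≁apex {t} (inj₁ (_ , a)) with () ← trans (sym a) (no-arc-apex-ιᵀ t)
    ιᵀ≁apex {t} (inj₂ (r , _)) with () ← ≺⁻ apex (ιᵀ t) refl (key-ιᵀ t) r

    ιᵀ≁ιᴰ : ∀ {t x} → ¬ Backedge G _≺_ (ιᵀ t) (ιᴰ x)
    ιᵀ≁ιᴰ {t} {x} (inj₁ (r , _)) with ₁∼₁ () ← ≺⁻ (ιᵀ t) (ιᴰ x) (key-ιᵀ t) (key-ιᴰ x) r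
    ιᵀ≁ιᴰ {t} {x} (inj₂ (_ , a)) with () ← trans (sym a) (no-arc-ιᵀ-ιᴰ t x)

    T-neighbour : ∀ {u} → IsT u → ∀ w → Backedge G _≺_ u w → IsT w
    T-neighbour (t , refl) w u~w with classify w
    ... | is-apex = ⊥-elim (ιᵀ≁apex {t} u~w)
    ... | is-D x  = ⊥-elim (ιᵀ≁ιᴰ {t} {x} u~w)
    ... | is-T s  = s , refl

    apex-neighbour : ∀ w → Backedge G _≺_ apex w → IsD w
    apex-neighbour w apex~w with classify w
    ... | is-apex = ⊥-elim (backedge-irrefl {D = G} {R = _≺_} ≺-isTotalOrder {apex} apex~w)
    ... | is-D x  = x , refl
    ... | is-T t  = ⊥-elim (ιᵀ≁apex {t} (backedge-sym {D = G} {R = _≺_} {apex} {ιᵀ t} apex~w))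

    module _ (ωᵀ : CliqueNumber (Backedge Tk Rᵀ) (suc k)) (ωᴰ : CliqueNumber (Backedge D R) k) where

      clique-containing-apex-bound : (c : Clique (Backedge G _≺_) m) (i : Fin m) →
                                     member c i ≡ apex → m ≤ suc k
      clique-containing-apex-bound {suc m} c i cᵢ≡apex = s≤s (clique≤cliqueNumber ωᴰ
        (embedding-clique-pull D↪G (Equivalence.from ≺-ιᴰ) (clique-delete c i) λ j →
          apex-neighbour _ (subst (λ u → Backedge G _≺_ u (member c (punchIn i j))) cᵢ≡apex
                                  (adjacent c (punchInᵢ≢i i j ∘ sym)))))

      glued-clique-bound : Clique (Backedge G _≺_) m → m ≤ suc k
      glued-clique-bound c with any? (isT? ∘ member c)
      ... | yes (i , Tᵢ) = clique≤cliqueNumber ωᵀ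
        (embedding-clique-pull T↪G (Equivalence.from ≺-ιᵀ) c
          (clique-closed {P = IsT} c i Tᵢ (T-neighbour Tᵢ)))
      ... | no ¬T with any? (λ i → member c i ≟ᶠ apex)
      ...   | yes (i , cᵢ≡apex) = clique-containing-apex-bound c i cᵢ≡apex
      ...   | no ¬apex = m≤n⇒m≤1+n (clique≤cliqueNumber ωᴰ
        (embedding-clique-pull D↪G (Equivalence.from ≺-ιᴰ) c λ i →
          isD-if-not-apex-nor-T (¬apex ∘ (i ,_)) (¬T ∘ (i ,_))))

      glued-cliqueNumber : CliqueNumber (Backedge G _≺_) (suc k)
      glued-cliqueNumber = cliqueNumber-intro (backedge? ≺-isTotalOrder)
        (embedding-clique-map T↪G (Equivalence.to ≺-ιᵀ) (cliqueNumber⇒clique ωᵀ)) glued-clique-bound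

  module Optimal {T : Digraph m} (ω⃗ᵀ : DiCliqueNumber T (suc k))
                 (copy : (X : Subset p) → ContainsCopy Tk X T ⊎ ContainsCopy Tk (∁ X) T)
                 {_≺_ : Rel V 0ℓ} (O : IsTotalOrder _≺_) (ω : CliqueNumber (Backedge G _≺_) (suc k)) where
    open IsStrictTotalOrder O using (compare; _<?_) renaming (trans to ≺-trans)

    after-apex : ∀ t → ¬ ιᵀ t ≺ apex → apex ≺ ιᵀ t
    after-apex t t⊀apex with compare apex (ιᵀ t)
    ... | tri< apex≺t _ _ = apex≺t
    ... | tri> _ _ t≺apex = ⊥-elim (t⊀apex t≺apex)

    before-apex? : Decidable₁ λ t → ιᵀ t ≺ apex
    before-apex? t = ιᵀ t <? apex

    ιᴰ≺apex : ∀ x → ιᴰ x ≺ apex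
    ιᴰ≺apex x with compare (ιᴰ x) apex
    ... | tri< x≺apex _ _ = x≺apex
    ... | tri> _ _ apex≺x with copy (subsetOf before-apex?)
    ...   | inj₁ c@(f , _ , f∈X , _) =
      ⊥-elim (copy-not-dominated O ω ω⃗ᵀ (T↪G ∘ᴱ copy⇒embedding c) (ιᴰ x) λ a →
        inj₂ (≺-trans (Equivalence.to (∈-subsetOf before-apex?) (f∈X a)) apex≺x , arc-ιᴰ-ιᵀ x (f a)))
    ...   | inj₂ c@(f , _ , f∈∁X , _) =
      ⊥-elim (copy-not-dominated O ω ω⃗ᵀ (T↪G ∘ᴱ copy⇒embedding c) apex λ a →
        inj₁ (after-apex (f a) (x∈∁p⇒x∉p (f∈∁X a) ∘ Equivalence.from (∈-subsetOf before-apex?)) ,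
              arc-ιᵀ-apex (f a)))

    restriction-cliqueNumber : DiCliqueNumber D k → CliqueNumber (Backedge D (_≺_ on ιᴰ)) k
    restriction-cliqueNumber ω⃗ᴰ = cliqueNumber-intro (backedge? Oᴰ) (diCliqueNumber⇒clique ω⃗ᴰ Oᴰ) λ c →
      s≤s⁻¹ (clique≤cliqueNumber ω
        (clique-extend (backedge-sym {D = G} {R = _≺_}) (backedge-irrefl {D = G} O)
          (embedding-clique-map D↪G id c) apex λ _ → inj₂ (ιᴰ≺apex _ , arc-apex-ιᴰ _)))
      where
      Oᴰ : IsTotalOrder (_≺_ on ιᴰ)
      Oᴰ = isStrictTotalOrder-on ιᴰ (Embedding.injective D↪G) O

lemma3p6 : (k : ℕ) → 1 ≤ k → (p : ℕ) → (Tk : Digraph p) → IsTournament Tk →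
    DiCliqueNumber Tk k →
    (Σ ℕ λ m → Σ (Digraph m) λ T → IsTournament T × DiCliqueNumber T k ×
      ((X : Subset p) → ContainsCopy Tk X T ⊎ ContainsCopy Tk (∁ X) T)) →
    (n : ℕ) → (D : Digraph n) → Loopless D → DiCliqueNumber D (k ∸ 1) →
    DiCliqueNumber (Δ One D Tk) k
    × ((R : Fin n → Fin n → Set) → IsTotalOrder R → CliqueNumber (Backedge D R) (k ∸ 1) →
         Σ (Fin (1 + (n + p)) → Fin (1 + (n + p)) → Set) λ R' →
           IsTotalOrder R' × CliqueNumber (Backedge (Δ One D Tk) R') k
           × ((x y : Fin n) → R x y ⇔ restrictD {n} {p} R' x y))
    × ((R' : Fin (1 + (n + p)) → Fin (1 + (n + p)) → Set) → IsTotalOrder R' →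
         CliqueNumber (Backedge (Δ One D Tk) R') k →
         CliqueNumber (Backedge D (restrictD {n} {p} R')) (k ∸ 1))
lemma3p6 (suc k) _ p Tk _ ω⃗ᵀᵏ@((_ , Oᵀ , ωᵀ) , _) (_ , T , _ , ω⃗ᵀ , copy)
         n D _ ω⃗ᴰ@((_ , Oᴰ , ωᴰ) , _) =
  ((_ , Glued.≺-isTotalOrder Oᴰ Oᵀ , Glued.glued-cliqueNumber Oᴰ Oᵀ ωᵀ ωᴰ) ,
   λ _ O _ ω → diCliqueNumber≤cliqueNumber ω⃗ᵀᵏ O ω) ,
  (λ _ O ω → let open Glued O Oᵀ in _ , ≺-isTotalOrder , glued-cliqueNumber ωᵀ ω , λ _ _ → ≺-ιᴰ) ,
  (λ _ O ω → Optimal.restriction-cliqueNumber ω⃗ᵀ copy O ω ω⃗ᴰ)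
  where open Triangle D Tk
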